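{- There exists a constant $c>0$ and an integer $n_0$ such that for every $n\ge n_0$, the hypercube $Q_n$ contains at least $cn$ pairwise completely independent spanning trees. (That is, there are $\Omega(n)$ completely independent spanning trees in $Q_n$.)
   Context: The hypercube $Q_n$ has vertex set $\{0,1\}^n$, two vertices being adjacent if they differ in exactly one coordinate. Two spanning trees of a graph $G$ are completely independent if they have no edge in common and, for every pair of vertices $u,v$ of $G$, the $u$–$v$ paths in the two trees have no vertex in common other than $u$ and $v$. A set of spanning trees is completely independent if its members are pairwise completely independent. -}

module Defs where

open import Data.Nat using (ℕ; zero; suc; _+_; _≤_)
open import Data.Bool using (Bool; if_then_else_; _xor_)
open import Data.Vec using (Vec; []; _∷_)
open import Data.Fin using (Fin)
open import Data.List using (List; []; _∷_)
open import Data.List.Membership.Propositional using (_∈_)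
open import Data.List.Relation.Unary.Unique.Propositional using (Unique)
open import Data.Product using (Σ; _×_; ∃)
open import Data.Sum using (_⊎_)
open import Relation.Nullary using (¬_)
open import Relation.Binary.PropositionalEquality using (_≡_)

V : ℕ → Set
V n = Vec Bool n

hamming : ∀ {n} → V n → V n → ℕ
hamming [] [] = 0
hamming (a ∷ u) (b ∷ v) = (if a xor b then 1 else 0) + hamming u v

QAdj : ∀ {n} → V n → V n → Set
QAdj u v = hamming u v ≡ 1

-- A (spanning) subgraph of Q_n is given by its edge relation
EdgeRel : ℕ → Set₁
EdgeRel n = V n → V n → Set

module _ {n : ℕ} (E : EdgeRel n) where

  data Walk : V n → V n → Set where
    [] : ∀ {u} → Walk u u
    _∷_ : ∀ {u w v} → E u w → Walk w v → Walk u v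

  verts : ∀ {u v} → Walk u v → List (V n)
  verts {u} [] = u ∷ []
  verts {u} (e ∷ p) = u ∷ verts p

  len : ∀ {u v} → Walk u v → ℕ
  len [] = 0
  len (e ∷ p) = suc (len p)

  IsPath : ∀ {u v} → Walk u v → Set
  IsPath p = Unique (verts p)

  Connected : Set
  Connected = ∀ u v → Walk u v

  -- a cycle through u: an edge u–w together with a path from w back to u
  -- of length ≥ 2 (so the cycle has ≥ 3 distinct vertices)
  HasCycle : Set
  HasCycle = Σ (V n) λ u → Σ (V n) λ w → E u w × Σ (Walk w u) λ p → IsPath p × 2 ≤ len p

  Acyclic : Set
  Acyclic = ¬ HasCycle

IsSpanningTree : ∀ {n} → EdgeRel n → Set
IsSpanningTree {n} T =
  (∀ u v → T u v → QAdj u v) ×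
  (∀ u v → T u v → T v u) ×
  Connected T × Acyclic T

CompletelyIndependent : ∀ {n} → EdgeRel n → EdgeRel n → Set
CompletelyIndependent {n} T₁ T₂ =
  (∀ u v → T₁ u v → T₂ u v → ⊥') ×
  (∀ u v (p : Walk T₁ u v) (q : Walk T₂ u v) → IsPath T₁ p → IsPath T₂ q →
     ∀ x → x ∈ verts T₁ p → x ∈ verts T₂ q → x ≡ u ⊎ x ≡ v)
  where open import Data.Empty renaming (⊥ to ⊥')

CISTFamily : (n k : ℕ) → Set₁
CISTFamily n k = Σ (Fin k → EdgeRel n) λ T →
  (∀ i → IsSpanningTree (T i)) ×
  (∀ i j → ¬ (i ≡ j) → CompletelyIndependent (T i) (T j))

module Submission where

-- Write n = 4·2ᵗ + r with r < 4·2ᵗ and split a vertex of Q_n into four blocks z, u, y₁, y₂ of 2ᵗ bits,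
-- whose positions are the words of length t, and r padding bits.  There is one tree for each word s,
-- so 2ᵗ ≥ n/8 trees.  Every vertex gets a colour: the hubs (z = unit s, u = 0) have colour s, and any
-- other vertex has colour syndrome y₁ ⊕ syndrome y₂ ⊕ (position of the first one of u), which a single
-- flip in y₁ or y₂ can change to any prescribed word.  Tree s is given by parent pointers: a vertex of
-- another colour is a leaf hanging from a neighbour of colour s, and a vertex of colour s walks inside
-- its colour class (z towards unit s, then u down to 0 without moving its first one, then y₁, y₂ and
-- the padding down to 0) to the root (unit s, 0, 0, 0, 0).  A decreasing rank makes each of these a
-- spanning tree.  All inner vertices of tree s have colour s, and the leaf edges between two colour
-- classes are oriented by comparing the colours, so the trees are pairwise completely independent.

open import Defs
open import Data.Bool using (Bool; true; false; not; _xor_; if_then_else_)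
open import Data.Bool.Properties
  using (xor-comm; xor-assoc; xor-identityˡ; xor-identityʳ; xor-same; true-xor; not-distribˡ-xor;
         not-distribʳ-xor; not-involutive; not-¬)
  renaming (_≟_ to _≟𝔹_)
open import Data.Empty using (⊥; ⊥-elim)
open import Data.Fin as Fin using (Fin; zero)
open import Data.Fin.Properties using (join-splitAt)
open import Data.List using ([]; _∷_)
open import Data.List.Membership.Propositional using (_∈_; _∉_)
open import Data.List.Relation.Unary.All using (_∷_)
open import Data.List.Relation.Unary.All.Properties using (All¬⇒¬Any)
open import Data.List.Relation.Unary.AllPairs using (_∷_)
open import Data.List.Relation.Unary.Any using (here; there)
open import Data.List.Relation.Unary.Unique.Propositional using (Unique)
open import Data.Maybe as Maybe using (Maybe; just; nothing; _<∣>_)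
open import Data.Nat using (ℕ; zero; suc; _+_; _*_; _≤_; _<_; _≥_; s≤s; z≤n)
open import Data.Nat.Properties
  using (<-trans; <-asym; <-≤-trans; ≤-refl; ≤-reflexive; ≤-trans; <⇒≤; <⇒≢; +-suc; +-assoc; +-identityʳ;
         +-monoˡ-<; +-monoʳ-<; +-monoʳ-≤; m≤m+n; m≤n*m; m≤n⇒m<n∨m≡n; m≤n⇒∃[o]m+o≡n)
open import Data.Nat.Tactic.RingSolver using (solve-∀)
open import Data.Product using (Σ; _×_; _,_; proj₁; proj₂)
open import Data.Sum using (_⊎_; inj₁; inj₂; swap; [_,_]′)
open import Data.Unit using (⊤; tt)
open import Data.Vec using (Vec; []; _∷_; _++_; replicate; zipWith; take; drop)
open import Data.Vec.Properties
  using (≡-dec; zipWith-assoc; zipWith-comm; zipWith-identityˡ; ++-injectiveˡ; ++-injectiveʳ;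
         take++drop≡id; ∷-injectiveʳ)
open import Function using (_$_; _∘_)
open import Relation.Nullary using (¬_; Dec; yes; no; contradiction)
open import Relation.Binary.PropositionalEquality
  using (_≡_; _≢_; refl; sym; trans; cong; cong₂; subst; subst₂; module ≡-Reasoning)
open ≡-Reasoning

∉-tail : ∀ {A : Set} {x : A} {xs} → Unique (x ∷ xs) → x ∉ xs
∉-tail (x∉xs ∷ _) = All¬⇒¬Any x∉xs

hamming-sym : ∀ {n} (u v : V n) → hamming u v ≡ hamming v u
hamming-sym []      []      = refl
hamming-sym (a ∷ u) (b ∷ v) =
  cong₂ _+_ (cong (λ c → if c then 1 else 0) (xor-comm a b)) (hamming-sym u v)

_≟V_ : ∀ {n} (u v : V n) → Dec (u ≡ v)
_≟V_ = ≡-dec _≟𝔹_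

hamming-self : ∀ {m} (v : Vec Bool m) → hamming v v ≡ 0
hamming-self []      = refl
hamming-self (a ∷ v) rewrite xor-same a = hamming-self v

hamming-++ : ∀ {m k} (a c : Vec Bool m) (b d : Vec Bool k) →
             hamming (a ++ b) (c ++ d) ≡ hamming a c + hamming b d
hamming-++ []      []      b d = refl
hamming-++ (x ∷ a) (y ∷ c) b d =
  trans (cong (_ +_) (hamming-++ a c b d)) (sym (+-assoc (if x xor y then 1 else 0) _ _))

hamming-++-prefix : ∀ {m k} (a : Vec Bool m) (b d : Vec Bool k) →
                    hamming (a ++ b) (a ++ d) ≡ hamming b d
hamming-++-prefix a b d = trans (hamming-++ a a b d) (cong (_+ hamming b d) (hamming-self a))

hamming-++-suffix : ∀ {m k} (a c : Vec Bool m) (b : Vec Bool k) →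
                    hamming (a ++ b) (c ++ b) ≡ hamming a c
hamming-++-suffix a c b =
  trans (hamming-++ a c b b) (trans (cong (hamming a c +_) (hamming-self b)) (+-identityʳ _))

take-++ : ∀ {A : Set} {m k} (a : Vec A m) (b : Vec A k) → take m (a ++ b) ≡ a
take-++ {m = m} a b = ++-injectiveˡ (take m (a ++ b)) a (take++drop≡id m (a ++ b))

drop-++ : ∀ {A : Set} {m k} (a : Vec A m) (b : Vec A k) → drop m (a ++ b) ≡ b
drop-++ {m = m} a b = ++-injectiveʳ (take m (a ++ b)) a (take++drop≡id m (a ++ b))

module ParentTree {n : ℕ} (parent : V n → V n) (rank : V n → ℕ) where

  Step : V n → V n → Set
  Step a b = parent a ≡ b × rank b < rank a

  Edge : EdgeRel n
  Edge a b = Step a b ⊎ Step b a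

  head∈verts : ∀ {a b} (p : Walk Edge a b) → a ∈ verts Edge p
  head∈verts []      = here refl
  head∈verts (_ ∷ _) = here refl

  last∈verts : ∀ {a b} (p : Walk Edge a b) → b ∈ verts Edge p
  last∈verts []      = here refl
  last∈verts (_ ∷ p) = there (last∈verts p)

  -- once a path without repetitions steps down to a child it can never step up again
  rank-increases : ∀ {a w b} → Step w a → (p : Walk Edge w b) → Unique (a ∷ verts Edge p) →
                   rank a < rank b
  rank-increases (_ , a<w) [] _ = a<w
  rank-increases (w↑a , _) (inj₁ (w↑x , _) ∷ p) ((_ ∷ a∉p) ∷ _) =
    ⊥-elim (All¬⇒¬Any a∉p (subst (_∈ _) (trans (sym w↑x) w↑a) (head∈verts p)))
  rank-increases (_ , a<w) (inj₂ x↑w ∷ p) (_ ∷ u) = <-trans a<w (rank-increases x↑w p u)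

  IsUp : ∀ {a b} → Edge a b → Set
  IsUp (inj₁ _) = ⊤
  IsUp (inj₂ _) = ⊥

  StartsUp : ∀ {a b} → Walk Edge a b → Set
  StartsUp []      = ⊥
  StartsUp (e ∷ _) = IsUp e

  EndsUp : ∀ {a b} → Walk Edge a b → Set
  EndsUp []                = ⊥
  EndsUp (e ∷ [])          = IsUp e
  EndsUp (_ ∷ p@(_ ∷ _))   = EndsUp p

  rank-decreases : ∀ {a b} (p : Walk Edge a b) → Unique (verts Edge p) → EndsUp p →
                   rank b < rank a × StartsUp p
  rank-decreases (inj₁ (_ , b<a) ∷ []) _ _ = b<a , tt
  rank-decreases (e ∷ p@(e′ ∷ q)) (a∉p ∷ u) up with rank-decreases p u up
  rank-decreases (inj₁ (_ , w<a) ∷ p) _ _ | b<w , _ = <-trans b<w w<a , tt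
  rank-decreases (inj₂ (w↑a , _) ∷ inj₁ (w↑x , _) ∷ q) (a∉p ∷ u) _ | _ =
    ⊥-elim (∉-tail (a∉p ∷ u) (there (subst (_∈ _) (trans (sym w↑x) w↑a) (head∈verts q))))
  rank-decreases (inj₂ _ ∷ inj₂ _ ∷ _) _ _ | _ , ()

  ends-up-or-revisits-parent : ∀ {a c b} (e : Edge a c) (p : Walk Edge c b) →
                               EndsUp (e ∷ p) ⊎ parent b ∈ verts Edge (e ∷ p)
  ends-up-or-revisits-parent (inj₁ _)        [] = inj₁ tt
  ends-up-or-revisits-parent (inj₂ (b↑a , _)) [] = inj₂ (here b↑a)
  ends-up-or-revisits-parent _ (e′ ∷ p) with ends-up-or-revisits-parent e′ p
  ... | inj₁ up = inj₁ up
  ... | inj₂ m  = inj₂ (there m)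

  -- On a cycle through the edge u–w, the path from w back to u would have to step down first
  -- (if u is the parent of w) or step up last (if w is the parent of u), forcing rank u > rank w,
  -- respectively rank u < rank w.
  acyclic : Acyclic Edge
  acyclic (u , w , inj₂ (w↑u , u<w) , e ∷ p@(_ ∷ q) , uniq , s≤s (s≤s z≤n)) with e | uniq
  ... | inj₁ (w↑x , _) | _ ∷ u′ =
    ∉-tail u′ (subst (_∈ _) (trans (sym w↑u) w↑x) (last∈verts q))
  ... | inj₂ x↑w | uniq′ = <-asym u<w (rank-increases x↑w p uniq′)
  acyclic (u , w , inj₁ (u↑w , w<u) , e ∷ p@(e′ ∷ q) , uniq , s≤s (s≤s z≤n))
    with ends-up-or-revisits-parent e′ q
  ... | inj₁ up = <-asym w<u (proj₁ (rank-decreases (e ∷ p) uniq up))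
  ... | inj₂ m  = ∉-tail uniq (subst (_∈ _) u↑w m)

  module _ (root : V n) (toward-root : ∀ a → a ≡ root ⊎ rank (parent a) < rank a) where

    walk-to-root : ∀ a → Walk Edge a root
    walk-to-root a = climb (suc (rank a)) a ≤-refl
      where
        climb : ∀ fuel a → rank a < fuel → Walk Edge a root
        climb (suc fuel) a (s≤s a≤fuel) with toward-root a
        ... | inj₁ refl = []
        ... | inj₂ pa<a = inj₁ (refl , pa<a) ∷ climb fuel (parent a) (<-≤-trans pa<a a≤fuel)

    connected : Connected Edge
    connected a b = walk-to-root a ++ʷ reverse (walk-to-root b)
      where
        _++ʷ_ : ∀ {a b c} → Walk Edge a b → Walk Edge b c → Walk Edge a c
        []      ++ʷ q = q
        (e ∷ p) ++ʷ q = e ∷ (p ++ʷ q)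

        reverse : ∀ {a b} → Walk Edge a b → Walk Edge b a
        reverse []      = []
        reverse (e ∷ p) = reverse p ++ʷ (swap e ∷ [])

    isSpanningTree : (∀ a → rank (parent a) < rank a → QAdj a (parent a)) → IsSpanningTree Edge
    isSpanningTree adj = edge-adjacent , (λ _ _ → swap) , connected , acyclic
      where
        edge-adjacent : ∀ a b → Edge a b → QAdj a b
        edge-adjacent a _ (inj₁ (refl , pa<a)) = adj a pa<a
        edge-adjacent _ b (inj₂ (refl , pb<b)) = trans (hamming-sym (parent b) b) (adj b pb<b)

  two-neighbours-parent : ∀ {x a b} → Edge x a → Edge x b → a ≢ b → Σ (V n) λ y → parent y ≡ x
  two-neighbours-parent (inj₁ (x↑a , _)) (inj₁ (x↑b , _)) a≢b =
    ⊥-elim (a≢b (trans (sym x↑a) x↑b))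
  two-neighbours-parent (inj₂ (a↑x , _)) _ _ = _ , a↑x
  two-neighbours-parent (inj₁ _) (inj₂ (b↑x , _)) _ = _ , b↑x

  inner-vertex-is-parent : ∀ {u v x} (p : Walk Edge u v) → Unique (verts Edge p) →
                           x ∈ verts Edge p → x ≢ u → x ≢ v → Σ (V n) λ y → parent y ≡ x
  inner-vertex-is-parent []      _ (here x≡u) x≢u _ = ⊥-elim (x≢u x≡u)
  inner-vertex-is-parent (_ ∷ _) _ (here x≡u) x≢u _ = ⊥-elim (x≢u x≡u)
  inner-vertex-is-parent (_ ∷ []) _ (there (here x≡v)) _ x≢v = ⊥-elim (x≢v x≡v)
  inner-vertex-is-parent (e ∷ e′ ∷ p) (u∉ ∷ uniq) (there (here refl)) _ _ =
    two-neighbours-parent (swap e) e′ λ u≡c →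
      ∉-tail (u∉ ∷ uniq) (there (subst (_∈ _) (sym u≡c) (head∈verts p)))
  inner-vertex-is-parent (e ∷ p@(_ ∷ _)) (_ ∷ uniq) (there (there x∈p)) _ x≢v =
    inner-vertex-is-parent p uniq (there x∈p) (λ { refl → ∉-tail uniq x∈p }) x≢v

-- An inner vertex of a path is the parent of one of its two neighbours there, so a vertex inner to
-- paths of both trees would lie in both cores.
module _ {n : ℕ} {parent₁ parent₂ : V n → V n} {rank₁ rank₂ : V n → ℕ}
         (Core₁ Core₂ : V n → Set)
         (parent₁-core : ∀ a → Core₁ (parent₁ a)) (parent₂-core : ∀ a → Core₂ (parent₂ a))
         (cores-disjoint : ∀ x → Core₁ x → Core₂ x → ⊥)
         (no-reversed-edge : ∀ a b → parent₁ a ≡ b → parent₂ b ≡ a → ⊥) where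

  private
    module T₁ = ParentTree parent₁ rank₁
    module T₂ = ParentTree parent₂ rank₂

  completelyIndependent : CompletelyIndependent T₁.Edge T₂.Edge
  completelyIndependent = edge-disjoint , inner-vertices-disjoint
    where
      common-parent : ∀ {a a′ x} → parent₁ a ≡ x → parent₂ a′ ≡ x → ⊥
      common-parent {a} {a′} a↑x a′↑x =
        cores-disjoint _ (subst Core₁ a↑x (parent₁-core a))
                         (subst Core₂ a′↑x (parent₂-core a′))

      edge-disjoint : ∀ u v → T₁.Edge u v → T₂.Edge u v → ⊥
      edge-disjoint u v (inj₁ (u↑v , _)) (inj₁ (u↑′v , _)) = common-parent u↑v u↑′v
      edge-disjoint u v (inj₁ (u↑v , _)) (inj₂ (v↑′u , _)) = no-reversed-edge u v u↑v v↑′u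
      edge-disjoint u v (inj₂ (v↑u , _)) (inj₁ (u↑′v , _)) = no-reversed-edge v u v↑u u↑′v
      edge-disjoint u v (inj₂ (v↑u , _)) (inj₂ (v↑′u , _)) = common-parent v↑u v↑′u

      inner-vertices-disjoint : ∀ u v (p : Walk T₁.Edge u v) (q : Walk T₂.Edge u v) →
        IsPath T₁.Edge p → IsPath T₂.Edge q →
        ∀ x → x ∈ verts T₁.Edge p → x ∈ verts T₂.Edge q → x ≡ u ⊎ x ≡ v
      inner-vertices-disjoint u v p q up uq x x∈p x∈q with x ≟V u | x ≟V v
      ... | yes x≡u | _       = inj₁ x≡u
      ... | no _    | yes x≡v = inj₂ x≡v
      ... | no x≢u  | no x≢v  = ⊥-elim $
        common-parent (proj₂ (T₁.inner-vertex-is-parent p up x∈p x≢u x≢v))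
                      (proj₂ (T₂.inner-vertex-is-parent q uq x∈q x≢u x≢v))

Bits : ℕ → Set
Bits = Vec Bool

0ᵇ : ∀ {t} → Bits t
0ᵇ = replicate _ false

infixl 6 _⊕_
_⊕_ : ∀ {t} → Bits t → Bits t → Bits t
_⊕_ = zipWith _xor_

⊕-assoc : ∀ {t} (x y z : Bits t) → x ⊕ y ⊕ z ≡ x ⊕ (y ⊕ z)
⊕-assoc = zipWith-assoc xor-assoc

⊕-comm : ∀ {t} (x y : Bits t) → x ⊕ y ≡ y ⊕ x
⊕-comm = zipWith-comm xor-comm

⊕-identityˡ : ∀ {t} (x : Bits t) → 0ᵇ ⊕ x ≡ x
⊕-identityˡ = zipWith-identityˡ xor-identityˡ

⊕-self : ∀ {t} (x : Bits t) → x ⊕ x ≡ 0ᵇ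
⊕-self []      = refl
⊕-self (a ∷ x) = cong₂ _∷_ (xor-same a) (⊕-self x)

⊕-cancelˡ : ∀ {t} (x y : Bits t) → x ⊕ (x ⊕ y) ≡ y
⊕-cancelˡ x y = begin
  x ⊕ (x ⊕ y) ≡⟨ ⊕-assoc x x y ⟨
  x ⊕ x ⊕ y   ≡⟨ cong (_⊕ y) (⊕-self x) ⟩
  0ᵇ ⊕ y      ≡⟨ ⊕-identityˡ y ⟩
  y           ∎

⊕-swapʳ : ∀ {t} (x y z : Bits t) → x ⊕ y ⊕ z ≡ x ⊕ z ⊕ y
⊕-swapʳ x y z = begin
  x ⊕ y ⊕ z   ≡⟨ ⊕-assoc x y z ⟩
  x ⊕ (y ⊕ z) ≡⟨ cong (x ⊕_) (⊕-comm y z) ⟩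
  x ⊕ (z ⊕ y) ≡⟨ ⊕-assoc x z y ⟨
  x ⊕ z ⊕ y   ∎

-- A block of height t is a bit string of length 2ᵗ whose positions are the words of Bits t.
data Block : ℕ → Set where
  leaf : Bool → Block zero
  node : ∀ {t} → Block t → Block t → Block (suc t)

bit : ∀ {t} → Bits t → Block t → Bool
bit []          (leaf a)   = a
bit (false ∷ i) (node l _) = bit i l
bit (true ∷ i)  (node _ r) = bit i r

flip : ∀ {t} → Bits t → Block t → Block t
flip []          (leaf a)   = leaf (not a)
flip (false ∷ i) (node l r) = node (flip i l) r
flip (true ∷ i)  (node l r) = node l (flip i r)

0ᴮ : ∀ {t} → Block t
0ᴮ {zero}  = leaf false
0ᴮ {suc t} = node 0ᴮ 0ᴮ

unit : ∀ {t} → Bits t → Block t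
unit i = flip i 0ᴮ

firstOne : ∀ {t} → Block t → Maybe (Bits t)
firstOne (leaf true)  = just []
firstOne (leaf false) = nothing
firstOne (node l r)   = Maybe.map (false ∷_) (firstOne l) <∣> Maybe.map (true ∷_) (firstOne r)

weight : ∀ {t} → Block t → ℕ
weight (leaf true)  = 1
weight (leaf false) = 0
weight (node l r)   = weight l + weight r

parity : ∀ {t} → Block t → Bool
parity (leaf a)   = a
parity (node l r) = parity l xor parity r

-- the XOR of the positions of the ones of a block, i.e. its Hamming-code syndrome
syndrome : ∀ {t} → Block t → Bits t
syndrome (leaf _)   = []
syndrome (node l r) = parity r ∷ (syndrome l ⊕ syndrome r)

bit-flip-same : ∀ {t} (i : Bits t) b → bit i (flip i b) ≡ not (bit i b)
bit-flip-same []          (leaf _)   = refl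
bit-flip-same (false ∷ i) (node l _) = bit-flip-same i l
bit-flip-same (true ∷ i)  (node _ r) = bit-flip-same i r

bit-flip-other : ∀ {t} {j i : Bits t} b → j ≢ i → bit j (flip i b) ≡ bit j b
bit-flip-other {j = []}        {[]}        (leaf _)   j≢i = ⊥-elim (j≢i refl)
bit-flip-other {j = false ∷ j} {false ∷ i} (node l _) j≢i = bit-flip-other l (j≢i ∘ cong (false ∷_))
bit-flip-other {j = false ∷ j} {true ∷ i}  (node _ _) _   = refl
bit-flip-other {j = true ∷ j}  {false ∷ i} (node _ _) _   = refl
bit-flip-other {j = true ∷ j}  {true ∷ i}  (node _ r) j≢i = bit-flip-other r (j≢i ∘ cong (true ∷_))

flip-involutive : ∀ {t} (i : Bits t) b → flip i (flip i b) ≡ b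
flip-involutive []          (leaf a)   = cong leaf (not-involutive a)
flip-involutive (false ∷ i) (node l r) = cong (λ l′ → node l′ r) (flip-involutive i l)
flip-involutive (true ∷ i)  (node l r) = cong (node l) (flip-involutive i r)

flip-≢ : ∀ {t} (i : Bits t) b → flip i b ≢ b
flip-≢ i b eq = not-¬ refl (trans (sym (cong (bit i) eq)) (bit-flip-same i b))

bit-0ᴮ : ∀ {t} (j : Bits t) → bit j 0ᴮ ≡ false
bit-0ᴮ []          = refl
bit-0ᴮ (false ∷ j) = bit-0ᴮ j
bit-0ᴮ (true ∷ j)  = bit-0ᴮ j

bit-unit-same : ∀ {t} (i : Bits t) → bit i (unit i) ≡ true
bit-unit-same i = trans (bit-flip-same i 0ᴮ) (cong not (bit-0ᴮ i))

bit-unit : ∀ {t} {j i : Bits t} → bit j (unit i) ≡ true → j ≡ i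
bit-unit {j = j} {i} eq with j ≟V i
... | yes j≡i = j≡i
... | no j≢i  = contradiction (trans (sym (bit-0ᴮ j)) (trans (sym (bit-flip-other 0ᴮ j≢i)) eq)) (λ ())

unit≢0ᴮ : ∀ {t} (i : Bits t) → unit i ≢ 0ᴮ
unit≢0ᴮ i eq = contradiction (trans (sym (bit-unit-same i)) (trans (cong (bit i) eq) (bit-0ᴮ i))) (λ ())

firstOne-0ᴮ : ∀ {t} → firstOne (0ᴮ {t}) ≡ nothing
firstOne-0ᴮ {zero}  = refl
firstOne-0ᴮ {suc t} rewrite firstOne-0ᴮ {t} = refl

firstOne-nothing : ∀ {t} (b : Block t) → firstOne b ≡ nothing → b ≡ 0ᴮ
firstOne-nothing (leaf false) _ = refl
firstOne-nothing (node l r) eq with firstOne l in l-empty | firstOne r in r-empty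
firstOne-nothing (node l r) refl | nothing | nothing =
  cong₂ node (firstOne-nothing l l-empty) (firstOne-nothing r r-empty)

firstOne-just : ∀ {t} (b : Block t) {i} → firstOne b ≡ just i → bit i b ≡ true
firstOne-just (leaf true) refl = refl
firstOne-just (node l r) eq with firstOne l in l-first | firstOne r in r-first
firstOne-just (node l r) refl | just _  | _      = firstOne-just l l-first
firstOne-just (node l r) refl | nothing | just _ = firstOne-just r r-first

firstOne-unit : ∀ {t} (i : Bits t) → firstOne (unit i) ≡ just i
firstOne-unit []                        = refl
firstOne-unit (false ∷ i) rewrite firstOne-unit i = refl
firstOne-unit {suc t} (true ∷ i) rewrite firstOne-0ᴮ {t} | firstOne-unit i = refl

firstOne-flip : ∀ {t} (b : Block t) {i j} → firstOne b ≡ just i → bit j b ≡ true → j ≢ i →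
             firstOne (flip j b) ≡ just i
firstOne-flip (leaf _) {[]} {[]} _ _ j≢i = ⊥-elim (j≢i refl)
firstOne-flip (node l r) {j = false ∷ j} eq bj j≢i with firstOne l in l-first
firstOne-flip (node l r) {j = false ∷ j} refl bj j≢i | just i
  rewrite firstOne-flip l l-first bj (j≢i ∘ cong (false ∷_)) = refl
firstOne-flip (node l r) {j = false ∷ j} eq bj j≢i | nothing =
  contradiction (trans (sym (trans (cong (bit j) (sym (firstOne-nothing l l-first))) bj)) (bit-0ᴮ j)) λ ()
firstOne-flip (node l r) {j = true ∷ j} eq bj j≢i with firstOne l in l-first | firstOne r in r-first
firstOne-flip (node l r) {j = true ∷ j} refl bj j≢i | just i  | _ = refl
firstOne-flip (node l r) {j = true ∷ j} refl bj j≢i | nothing | just i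
  rewrite firstOne-flip r r-first bj (j≢i ∘ cong (true ∷_)) = refl

other-one : ∀ {t} (b : Block t) {i j} → bit i b ≡ true → firstOne (flip i b) ≡ just j →
            j ≢ i × bit j b ≡ true
other-one b {i} {j} bi first≡j = j≢i , trans (sym (bit-flip-other b j≢i)) bj
  where
    bj : bit j (flip i b) ≡ true
    bj = firstOne-just (flip i b) first≡j

    j≢i : j ≢ i
    j≢i refl = not-¬ (sym bi) (trans (sym bj) (bit-flip-same i b))

weight-flip-one : ∀ {t} (i : Bits t) b → bit i b ≡ true → suc (weight (flip i b)) ≡ weight b
weight-flip-one []          (leaf true) _ = refl
weight-flip-one (false ∷ i) (node l r) bi = cong (_+ weight r) (weight-flip-one i l bi)
weight-flip-one (true ∷ i)  (node l r) bi =
  trans (sym (+-suc (weight l) _)) (cong (weight l +_) (weight-flip-one i r bi))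

weight-flip-firstOne : ∀ {t} (b : Block t) {i} → firstOne b ≡ just i → weight (flip i b) < weight b
weight-flip-firstOne b {i} eq = ≤-reflexive (weight-flip-one i b (firstOne-just b eq))

weight-flip-zero : ∀ {t} (i : Bits t) b → bit i b ≡ false → weight (flip i b) ≡ suc (weight b)
weight-flip-zero []          (leaf false) _ = refl
weight-flip-zero (false ∷ i) (node l r) bi = cong (_+ weight r) (weight-flip-zero i l bi)
weight-flip-zero (true ∷ i)  (node l r) bi =
  trans (cong (weight l +_) (weight-flip-zero i r bi)) (+-suc (weight l) _)

parity-flip : ∀ {t} (i : Bits t) b → parity (flip i b) ≡ not (parity b)
parity-flip []          (leaf _)   = refl
parity-flip (false ∷ i) (node l r) =
  trans (cong (_xor parity r) (parity-flip i l)) (sym (not-distribˡ-xor (parity l) (parity r)))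
parity-flip (true ∷ i)  (node l r) =
  trans (cong (parity l xor_) (parity-flip i r)) (sym (not-distribʳ-xor (parity l) (parity r)))

syndrome-flip : ∀ {t} (i : Bits t) b → syndrome (flip i b) ≡ syndrome b ⊕ i
syndrome-flip []          (leaf _)   = refl
syndrome-flip (false ∷ i) (node l r) = cong₂ _∷_ (sym (xor-identityʳ (parity r))) (begin
  syndrome (flip i l) ⊕ syndrome r ≡⟨ cong (_⊕ syndrome r) (syndrome-flip i l) ⟩
  syndrome l ⊕ i ⊕ syndrome r      ≡⟨ ⊕-swapʳ (syndrome l) i (syndrome r) ⟩
  syndrome l ⊕ syndrome r ⊕ i      ∎)
syndrome-flip (true ∷ i)  (node l r) = cong₂ _∷_ flipped-parity (begin
  syndrome l ⊕ syndrome (flip i r) ≡⟨ cong (syndrome l ⊕_) (syndrome-flip i r) ⟩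
  syndrome l ⊕ (syndrome r ⊕ i)    ≡⟨ ⊕-assoc (syndrome l) (syndrome r) i ⟨
  syndrome l ⊕ syndrome r ⊕ i      ∎)
  where
    flipped-parity : parity (flip i r) ≡ parity r xor true
    flipped-parity = trans (parity-flip i r) (trans (sym (true-xor (parity r))) (xor-comm true (parity r)))

-- one more than the Hamming distance from b to unit s
unitDistance : ∀ {t} → Bits t → Block t → ℕ
unitDistance s b = if bit s b then weight b else suc (suc (weight b))

unitDistance-one : ∀ {t} (s : Bits t) b → bit s b ≡ true → unitDistance s b ≡ weight b
unitDistance-one s b eq rewrite eq = refl

towardUnit : ∀ {t} → Bits t → Block t → Maybe (Block t)
towardUnit s b with bit s b
... | false = just (flip s b)
... | true with firstOne (flip s b)
...   | just j  = just (flip j b)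
...   | nothing = nothing

towardUnit-just : ∀ {t} (s : Bits t) b {b′} → towardUnit s b ≡ just b′ →
                  Σ (Bits t) λ k → b′ ≡ flip k b × unitDistance s b′ < unitDistance s b × bit s b′ ≡ true
towardUnit-just s b eq with bit s b in bs
towardUnit-just s b refl | false = s , refl , closer , bs′
  where
    bs′ : bit s (flip s b) ≡ true
    bs′ = trans (bit-flip-same s b) (cong not bs)

    closer : unitDistance s (flip s b) < suc (suc (weight b))
    closer = subst (_< _) (sym (unitDistance-one s (flip s b) bs′))
                   (≤-reflexive (cong suc (weight-flip-zero s b bs)))
... | true with firstOne (flip s b) in first≡j
towardUnit-just s b refl | true | just j = j , refl , closer , bs′
  where
    j≢s : j ≢ s
    j≢s = proj₁ (other-one b {s} bs first≡j)

    bs′ : bit s (flip j b) ≡ true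
    bs′ = trans (bit-flip-other b (j≢s ∘ sym)) bs

    closer : unitDistance s (flip j b) < weight b
    closer = subst (_< _) (sym (unitDistance-one s (flip j b) bs′))
                   (≤-reflexive (weight-flip-one j b (proj₂ (other-one b {s} bs first≡j))))

towardUnit-nothing : ∀ {t} (s : Bits t) b → towardUnit s b ≡ nothing → b ≡ unit s
towardUnit-nothing s b eq with bit s b
... | true with firstOne (flip s b) in first≡nothing
...   | nothing = trans (sym (flip-involutive s b)) (cong (flip s) (firstOne-nothing _ first≡nothing))

shrink : ∀ {t} → Block t → Block t
shrink b with firstOne b
... | nothing = b
... | just i with firstOne (flip i b)
...   | just j  = flip j b
...   | nothing = flip i b

shrink-spec : ∀ {t} (b : Block t) {i} → firstOne b ≡ just i →
              suc (weight (shrink b)) ≡ weight b × (Σ (Bits t) λ k → shrink b ≡ flip k b) ×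
              (firstOne (shrink b) ≡ just i ⊎ shrink b ≡ 0ᴮ)
shrink-spec b {i} _ with firstOne b in first≡i
shrink-spec b {i} refl | just i with firstOne (flip i b) in first≡j
... | just j = weight-flip-one j b bj , (j , refl) , inj₁ (firstOne-flip b first≡i bj j≢i)
  where
    bi = firstOne-just b first≡i
    j≢i = proj₁ (other-one b {i} bi first≡j)
    bj = proj₂ (other-one b {i} bi first≡j)
... | nothing =
  weight-flip-one i b (firstOne-just b first≡i) , (i , refl) , inj₂ (firstOne-nothing _ first≡j)

unitPosition : ∀ {t} → Block t → Maybe (Bits t)
unitPosition b with firstOne b
... | nothing = nothing
... | just i with firstOne (flip i b)
...   | nothing = just i
...   | just _  = nothing

unitPosition-unit : ∀ {t} (i : Bits t) → unitPosition (unit i) ≡ just i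
unitPosition-unit {t} i rewrite firstOne-unit i | flip-involutive i 0ᴮ | firstOne-0ᴮ {t} = refl

unitPosition-just : ∀ {t} (b : Block t) {i} → unitPosition b ≡ just i → b ≡ unit i
unitPosition-just b eq with firstOne b
... | just i with firstOne (flip i b) in first≡nothing
unitPosition-just b refl | just i | nothing =
  trans (sym (flip-involutive i b)) (cong (flip i) (firstOne-nothing _ first≡nothing))

-- lexicographic comparison; its antisymmetry orients the edges between two colour classes
greater : ∀ {t} → Bits t → Bits t → Bool
greater []          []          = false
greater (true ∷ x)  (true ∷ y)  = greater x y
greater (false ∷ x) (false ∷ y) = greater x y
greater (true ∷ _)  (false ∷ _) = true
greater (false ∷ _) (true ∷ _)  = false

greater-antisym : ∀ {t} {x y : Bits t} → x ≢ y → greater x y ≡ not (greater y x)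
greater-antisym {x = []}        {[]}        x≢y = ⊥-elim (x≢y refl)
greater-antisym {x = true ∷ x}  {true ∷ y}  x≢y = greater-antisym (x≢y ∘ cong (true ∷_))
greater-antisym {x = false ∷ x} {false ∷ y} x≢y = greater-antisym (x≢y ∘ cong (false ∷_))
greater-antisym {x = true ∷ _}  {false ∷ _} _   = refl
greater-antisym {x = false ∷ _} {true ∷ _}  _   = refl

ones : ∀ {m} → Vec Bool m → ℕ
ones []          = 0
ones (true ∷ v)  = suc (ones v)
ones (false ∷ v) = ones v

clearFirst : ∀ {m} → Vec Bool m → Maybe (Vec Bool m)
clearFirst []          = nothing
clearFirst (true ∷ v)  = just (false ∷ v)
clearFirst (false ∷ v) = Maybe.map (false ∷_) (clearFirst v)

clearFirst-nothing : ∀ {m} (v : Vec Bool m) → clearFirst v ≡ nothing → v ≡ replicate m false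
clearFirst-nothing [] _ = refl
clearFirst-nothing (false ∷ v) eq with clearFirst v in cleared
clearFirst-nothing (false ∷ v) refl | nothing = cong (false ∷_) (clearFirst-nothing v cleared)

clearFirst-just : ∀ {m} (v : Vec Bool m) {v′} → clearFirst v ≡ just v′ →
                  suc (ones v′) ≡ ones v × hamming v v′ ≡ 1
clearFirst-just (true ∷ v)  refl = refl , cong suc (hamming-self v)
clearFirst-just (false ∷ v) eq with clearFirst v in cleared
clearFirst-just (false ∷ v) refl | just _ = clearFirst-just v cleared

pow2 : ℕ → ℕ
pow2 zero    = 1
pow2 (suc t) = pow2 t + pow2 t

flatten : ∀ {t} → Block t → Vec Bool (pow2 t)
flatten (leaf a)   = a ∷ []
flatten (node l r) = flatten l ++ flatten r

unflatten : ∀ {t} → Vec Bool (pow2 t) → Block t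
unflatten {zero}  (a ∷ []) = leaf a
unflatten {suc t} v        = node (unflatten (take (pow2 t) v)) (unflatten (drop (pow2 t) v))

unflatten-flatten : ∀ {t} (b : Block t) → unflatten (flatten b) ≡ b
unflatten-flatten (leaf a)   = refl
unflatten-flatten (node l r) = cong₂ node
  (trans (cong unflatten (take-++ (flatten l) (flatten r))) (unflatten-flatten l))
  (trans (cong unflatten (drop-++ (flatten l) (flatten r))) (unflatten-flatten r))

flatten-unflatten : ∀ {t} (v : Vec Bool (pow2 t)) → flatten (unflatten {t} v) ≡ v
flatten-unflatten {zero}  (a ∷ []) = refl
flatten-unflatten {suc t} v =
  trans (cong₂ _++_ (flatten-unflatten {t} (take (pow2 t) v)) (flatten-unflatten {t} (drop (pow2 t) v)))
        (take++drop≡id (pow2 t) v)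

splitBlock : ∀ {t k} → Vec Bool (pow2 t + k) → Block t × Vec Bool k
splitBlock {t} x = unflatten (take (pow2 t) x) , drop (pow2 t) x

splitBlock-++ : ∀ {t k} (b : Block t) (x : Vec Bool k) → splitBlock (flatten b ++ x) ≡ (b , x)
splitBlock-++ b x =
  cong₂ _,_ (trans (cong unflatten (take-++ (flatten b) x)) (unflatten-flatten b)) (drop-++ (flatten b) x)

flatten-splitBlock : ∀ {t k} (x : Vec Bool (pow2 t + k)) →
                     flatten (proj₁ (splitBlock {t} x)) ++ proj₂ (splitBlock {t} x) ≡ x
flatten-splitBlock {t} x =
  trans (cong (_++ drop (pow2 t) x) (flatten-unflatten {t} (take (pow2 t) x))) (take++drop≡id (pow2 t) x)

hamming-flatten-flip : ∀ {t} (i : Bits t) (b : Block t) → hamming (flatten b) (flatten (flip i b)) ≡ 1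
hamming-flatten-flip []          (leaf true)  = refl
hamming-flatten-flip []          (leaf false) = refl
hamming-flatten-flip (false ∷ i) (node l r) =
  trans (hamming-++-suffix (flatten l) (flatten (flip i l)) (flatten r)) (hamming-flatten-flip i l)
hamming-flatten-flip (true ∷ i)  (node l r) =
  trans (hamming-++-prefix (flatten l) (flatten r) (flatten (flip i r))) (hamming-flatten-flip i r)

dim : ℕ → ℕ → ℕ
dim t r = pow2 t + (pow2 t + (pow2 t + (pow2 t + r)))

module Construction (t r : ℕ) where

  record Vertex : Set where
    constructor vertex
    field
      z u y₁ y₂ : Block t
      pad       : Vec Bool r

  open Vertex

  vertex-cong : ∀ {z z′ u u′ y₁ y₁′ y₂ y₂′ v v′} →
                z ≡ z′ → u ≡ u′ → y₁ ≡ y₁′ → y₂ ≡ y₂′ → v ≡ v′ →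
                vertex z u y₁ y₂ v ≡ vertex z′ u′ y₁′ y₂′ v′
  vertex-cong refl refl refl refl refl = refl

  hubOf : Block t → Block t → Maybe (Bits t)
  hubOf z u with firstOne u
  ... | just _  = nothing
  ... | nothing = unitPosition z

  hubOf-just : ∀ z u {s} → hubOf z u ≡ just s → z ≡ unit s × u ≡ 0ᴮ
  hubOf-just z u eq with firstOne u in u-empty
  ... | nothing = unitPosition-just z eq , firstOne-nothing u u-empty

  hubOf-unit : ∀ s → hubOf (unit s) 0ᴮ ≡ just s
  hubOf-unit s rewrite firstOne-0ᴮ {t} = unitPosition-unit s

  hubOf-zero : ∀ z u → firstOne u ≡ nothing → hubOf z u ≡ unitPosition z
  hubOf-zero z u eq rewrite eq = refl

  hubOf-nonzero : ∀ z u {i} → firstOne u ≡ just i → hubOf z u ≡ nothing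
  hubOf-nonzero z u eq rewrite eq = refl

  hub : Vertex → Maybe (Bits t)
  hub w = hubOf (z w) (u w)

  syndromeColour : Vertex → Bits t
  syndromeColour w = syndrome (y₁ w) ⊕ syndrome (y₂ w) ⊕ Maybe.fromMaybe 0ᵇ (firstOne (u w))

  colour : Vertex → Bits t
  colour w = Maybe.fromMaybe (syndromeColour w) (hub w)

  Core : Bits t → Vertex → Set
  Core s w = colour w ≡ s

  core-hub : ∀ {s} w → hub w ≡ just s → Core s w
  core-hub w = cong (Maybe.fromMaybe (syndromeColour w))

  core-nonhub : ∀ {s} w → hub w ≡ nothing → syndromeColour w ≡ s → Core s w
  core-nonhub w eq c = trans (cong (Maybe.fromMaybe (syndromeColour w)) eq) c

  syndromeColour-core : ∀ {s} w → hub w ≡ nothing → Core s w → syndromeColour w ≡ s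
  syndromeColour-core w eq c = trans (sym (core-nonhub w eq refl)) c

  root : Bits t → Vertex
  root s = vertex (unit s) 0ᴮ 0ᴮ 0ᴮ (replicate r false)

  flipY : Bool → Bits t → Vertex → Vertex
  flipY true  i (vertex z u y₁ y₂ v) = vertex z u (flip i y₁) y₂ v
  flipY false i (vertex z u y₁ y₂ v) = vertex z u y₁ (flip i y₂) v

  hubStep : Vertex → Vertex
  hubStep (vertex z u y₁ y₂ v) with firstOne y₁ | firstOne y₂ | clearFirst v
  ... | just i  | _       | _       = vertex z u (flip i y₁) y₂ v
  ... | nothing | just i  | _       = vertex z u y₁ (flip i y₂) v
  ... | nothing | nothing | just v′ = vertex z u y₁ y₂ v′
  ... | nothing | nothing | nothing = vertex z u y₁ y₂ v

  towardHub : Bits t → Vertex → Vertex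
  towardHub s (vertex z u y₁ y₂ v) with towardUnit s z
  ... | just z′ = vertex z′ u y₁ y₂ v
  ... | nothing = vertex z (shrink u) y₁ y₂ v

  coreStep : Bits t → Vertex → Vertex
  coreStep s w with hub w
  ... | just _  = hubStep w
  ... | nothing = towardHub s w

  leafStep : Bits t → Vertex → Vertex
  leafStep s w@(vertex z u y₁ y₂ v) with hub w
  ... | just _  = vertex z (unit (syndrome y₁ ⊕ syndrome y₂ ⊕ s)) y₁ y₂ v
  ... | nothing = flipY (greater (syndromeColour w) s) (syndromeColour w ⊕ s) w

  parent : Bits t → Vertex → Vertex
  parent s w with colour w ≟V s
  ... | yes _ = coreStep s w
  ... | no  _ = leafStep s w

  tailWeight : Vertex → ℕ
  tailWeight w = weight (y₁ w) + (weight (y₂ w) + ones (pad w))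

  hubDistance : Bits t → Vertex → ℕ
  hubDistance s w = Maybe.maybe′ (λ _ → 0) (suc (weight (u w) + unitDistance s (z w))) (hub w)

  coreRank : Bits t → Vertex → ℕ
  coreRank s w = tailWeight w + hubDistance s w

  hubDistance-hub : ∀ s {s′} w → hub w ≡ just s′ → hubDistance s w ≡ 0
  hubDistance-hub s w eq = cong (Maybe.maybe′ (λ _ → 0) _) eq

  hubDistance-nonhub : ∀ s w → hub w ≡ nothing →
                       hubDistance s w ≡ suc (weight (u w) + unitDistance s (z w))
  hubDistance-nonhub s w eq = cong (Maybe.maybe′ (λ _ → 0) _) eq

  rank : Bits t → Vertex → ℕ
  rank s w with colour w ≟V s
  ... | yes _ = coreRank s w
  ... | no  _ = suc (coreRank s (leafStep s w))

  encode : Vertex → V (dim t r)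
  encode w = flatten (z w) ++ flatten (u w) ++ flatten (y₁ w) ++ flatten (y₂ w) ++ pad w

  Adjacent : Vertex → Vertex → Set
  Adjacent w w′ = hamming (encode w) (encode w′) ≡ 1

  adjacent-z : ∀ k w → Adjacent w (record w { z = flip k (z w) })
  adjacent-z k w = trans (hamming-++-suffix (flatten (z w)) _ _) (hamming-flatten-flip k (z w))

  adjacent-u : ∀ k w → Adjacent w (record w { u = flip k (u w) })
  adjacent-u k w = trans (hamming-++-prefix (flatten (z w)) _ _)
                  (trans (hamming-++-suffix (flatten (u w)) _ _) (hamming-flatten-flip k (u w)))

  adjacent-y₁ : ∀ k w → Adjacent w (record w { y₁ = flip k (y₁ w) })
  adjacent-y₁ k w = trans (hamming-++-prefix (flatten (z w)) _ _)
                   (trans (hamming-++-prefix (flatten (u w)) _ _)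
                   (trans (hamming-++-suffix (flatten (y₁ w)) _ _) (hamming-flatten-flip k (y₁ w))))

  adjacent-y₂ : ∀ k w → Adjacent w (record w { y₂ = flip k (y₂ w) })
  adjacent-y₂ k w = trans (hamming-++-prefix (flatten (z w)) _ _)
                   (trans (hamming-++-prefix (flatten (u w)) _ _)
                   (trans (hamming-++-prefix (flatten (y₁ w)) _ _)
                   (trans (hamming-++-suffix (flatten (y₂ w)) _ _) (hamming-flatten-flip k (y₂ w)))))

  adjacent-pad : ∀ w {v′} → hamming (pad w) v′ ≡ 1 → Adjacent w (record w { pad = v′ })
  adjacent-pad w h = trans (hamming-++-prefix (flatten (z w)) _ _)
                    (trans (hamming-++-prefix (flatten (u w)) _ _)
                    (trans (hamming-++-prefix (flatten (y₁ w)) _ _)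
                    (trans (hamming-++-prefix (flatten (y₂ w)) _ _) h)))

  coreStep-hub : ∀ {s s′} w → hub w ≡ just s′ → coreStep s w ≡ hubStep w
  coreStep-hub w eq with hub w | eq
  ... | just _ | refl = refl

  coreStep-nonhub : ∀ {s} w → hub w ≡ nothing → coreStep s w ≡ towardHub s w
  coreStep-nonhub w eq with hub w | eq
  ... | nothing | refl = refl

  leafStep-hub : ∀ {s s′} w → hub w ≡ just s′ →
                 leafStep s w ≡ record w { u = unit (syndrome (y₁ w) ⊕ syndrome (y₂ w) ⊕ s) }
  leafStep-hub w eq with hub w | eq
  ... | just _ | refl = refl

  leafStep-nonhub : ∀ {s} w → hub w ≡ nothing →
                    leafStep s w ≡ flipY (greater (syndromeColour w) s) (syndromeColour w ⊕ s) w
  leafStep-nonhub w eq with hub w | eq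
  ... | nothing | refl = refl

  parent-leaf : ∀ {s} w → ¬ Core s w → parent s w ≡ leafStep s w
  parent-leaf {s} w ¬c with colour w ≟V s
  ... | yes c = contradiction c ¬c
  ... | no _  = refl

  rank-core : ∀ {s} w → Core s w → rank s w ≡ coreRank s w
  rank-core {s} w c with colour w ≟V s
  ... | yes _ = refl
  ... | no ¬c = contradiction c ¬c

  Descends : Bits t → Vertex → Vertex → Set
  Descends s w w′ = coreRank s w′ < coreRank s w × Adjacent w w′

  GoodCoreStep : Bits t → Vertex → Vertex → Set
  GoodCoreStep s w w′ = Core s w′ × ((w ≡ root s × w′ ≡ w) ⊎ Descends s w w′)

  hubStep-spec : ∀ {s} w → hub w ≡ just s → GoodCoreStep s w (hubStep w)
  hubStep-spec {s} w@(vertex z u y₁ y₂ v) hub≡s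
    with firstOne y₁ in y₁-first | firstOne y₂ in y₂-first | clearFirst v in v-cleared
  ... | just i | _ | _ =
    core-hub (vertex z u (flip i y₁) y₂ v) hub≡s ,
    inj₂ (+-monoˡ-< (hubDistance s w) (+-monoˡ-< _ (weight-flip-firstOne y₁ y₁-first)) ,
          adjacent-y₁ i w)
  ... | nothing | just i | _ =
    core-hub (vertex z u y₁ (flip i y₂) v) hub≡s ,
    inj₂ (+-monoˡ-< (hubDistance s w)
            (+-monoʳ-< (weight y₁) (+-monoˡ-< _ (weight-flip-firstOne y₂ y₂-first))) ,
          adjacent-y₂ i w)
  ... | nothing | nothing | just v′ =
    core-hub (vertex z u y₁ y₂ v′) hub≡s ,
    inj₂ (+-monoˡ-< (hubDistance s w)
            (+-monoʳ-< (weight y₁) (+-monoʳ-< (weight y₂)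
              (≤-reflexive (proj₁ (clearFirst-just v v-cleared))))) ,
          adjacent-pad w (proj₂ (clearFirst-just v v-cleared)))
  ... | nothing | nothing | nothing =
    core-hub w hub≡s ,
    inj₁ (vertex-cong (proj₁ (hubOf-just z u hub≡s)) (proj₂ (hubOf-just z u hub≡s))
                      (firstOne-nothing y₁ y₁-first) (firstOne-nothing y₂ y₂-first)
                      (clearFirst-nothing v v-cleared) ,
          refl)

  hubDistance-decreases : ∀ s w w′ → hub w ≡ nothing →
    (hub w′ ≡ nothing → weight (u w′) + unitDistance s (z w′) < weight (u w) + unitDistance s (z w)) →
    hubDistance s w′ < hubDistance s w
  hubDistance-decreases s w w′ nonhub closer = by-hub (hub w′) refl
    where
      w-distance : hubDistance s w ≡ suc (weight (u w) + unitDistance s (z w))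
      w-distance = hubDistance-nonhub s w nonhub

      by-hub : ∀ m → hub w′ ≡ m → hubDistance s w′ < hubDistance s w
      by-hub (just _) h′ = subst₂ _<_ (sym (hubDistance-hub s w′ h′)) (sym w-distance) (s≤s z≤n)
      by-hub nothing  h′ = subst₂ _<_ (sym (hubDistance-nonhub s w′ h′)) (sym w-distance) (s≤s (closer h′))

  towardHub-spec : ∀ {s} w → hub w ≡ nothing → syndromeColour w ≡ s → GoodCoreStep s w (towardHub s w)
  towardHub-spec {s} w@(vertex z u y₁ y₂ v) nonhub c with towardUnit s z in toward
  ... | just z′ with towardUnit-just s z toward
  ...   | k , refl , closer , bs′ =
    core′ (hub w′) refl ,
    inj₂ (+-monoʳ-< (tailWeight w) (hubDistance-decreases s w w′ nonhub λ _ → +-monoʳ-< _ closer) ,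
          adjacent-z k w)
    where
      w′ = vertex (flip k z) u y₁ y₂ v

      core′ : ∀ m → hub w′ ≡ m → Core s w′
      core′ (just s′) h′ =
        trans (core-hub w′ h′)
              (sym (bit-unit (subst (λ b → bit s b ≡ true) (proj₁ (hubOf-just (flip k z) u h′)) bs′)))
      core′ nothing h′ = core-nonhub w′ h′ c
  towardHub-spec {s} w@(vertex z u y₁ y₂ v) nonhub c | nothing = shrinking (firstOne u) refl
    where
      z≡unit : z ≡ unit s
      z≡unit = towardUnit-nothing s z toward

      w′ = vertex z (shrink u) y₁ y₂ v

      shrinking : ∀ m → firstOne u ≡ m → GoodCoreStep s w w′
      shrinking nothing u-empty =
        contradiction (begin
          nothing           ≡⟨ nonhub ⟨
          hubOf z u         ≡⟨ hubOf-zero z u u-empty ⟩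
          unitPosition z    ≡⟨ cong unitPosition z≡unit ⟩
          unitPosition (unit s) ≡⟨ unitPosition-unit s ⟩
          just s            ∎) λ ()
      shrinking (just i) u-first with shrink-spec u u-first
      ... | lighter , (k , shrink≡flip) , first-kept =
        by-first first-kept ,
        inj₂ (+-monoʳ-< (tailWeight w)
                (hubDistance-decreases s w w′ nonhub λ _ → +-monoˡ-< _ (≤-reflexive lighter)) ,
              subst (λ b → Adjacent w (vertex z b y₁ y₂ v)) (sym shrink≡flip) (adjacent-u k w))
        where
          by-first : firstOne (shrink u) ≡ just i ⊎ shrink u ≡ 0ᴮ → Core s w′
          by-first (inj₁ first′) =
            core-nonhub w′ (hubOf-nonzero z (shrink u) first′)
              (trans (cong (λ m → syndrome y₁ ⊕ syndrome y₂ ⊕ Maybe.fromMaybe 0ᵇ m)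
                           (trans first′ (sym u-first))) c)
          by-first (inj₂ emptied) = core-hub w′ (trans (cong₂ hubOf z≡unit emptied) (hubOf-unit s))

  coreStep-spec : ∀ {s} w → Core s w → GoodCoreStep s w (coreStep s w)
  coreStep-spec {s} w c = by-hub (hub w) refl
    where
      by-hub : ∀ m → hub w ≡ m → GoodCoreStep s w (coreStep s w)
      by-hub (just s′) h = subst (GoodCoreStep s w) (sym (coreStep-hub w h))
                                 (hubStep-spec w (trans h (cong just (trans (sym (core-hub w h)) c))))
      by-hub nothing   h = subst (GoodCoreStep s w) (sym (coreStep-nonhub w h))
                                 (towardHub-spec w h (syndromeColour-core w h c))

  flipY-hub : ∀ β i w → hub (flipY β i w) ≡ hub w
  flipY-hub true  _ _ = refl
  flipY-hub false _ _ = refl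

  flipY-u : ∀ β i w → u (flipY β i w) ≡ u w
  flipY-u true  _ _ = refl
  flipY-u false _ _ = refl

  flipY-adjacent : ∀ β i w → Adjacent w (flipY β i w)
  flipY-adjacent true  i w = adjacent-y₁ i w
  flipY-adjacent false i w = adjacent-y₂ i w

  flipY-mixedColour : ∀ β i w → syndromeColour (flipY β i w) ≡ syndromeColour w ⊕ i
  flipY-mixedColour true i (vertex _ u y₁ y₂ _) = begin
    syndrome (flip i y₁) ⊕ syndrome y₂ ⊕ L ≡⟨ cong (λ x → x ⊕ syndrome y₂ ⊕ L) (syndrome-flip i y₁) ⟩
    syndrome y₁ ⊕ i ⊕ syndrome y₂ ⊕ L      ≡⟨ cong (_⊕ L) (⊕-swapʳ (syndrome y₁) i (syndrome y₂)) ⟩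
    syndrome y₁ ⊕ syndrome y₂ ⊕ i ⊕ L      ≡⟨ ⊕-swapʳ (syndrome y₁ ⊕ syndrome y₂) i L ⟩
    syndrome y₁ ⊕ syndrome y₂ ⊕ L ⊕ i      ∎
    where L = Maybe.fromMaybe 0ᵇ (firstOne u)
  flipY-mixedColour false i (vertex _ u y₁ y₂ _) = begin
    syndrome y₁ ⊕ syndrome (flip i y₂) ⊕ L ≡⟨ cong (λ x → syndrome y₁ ⊕ x ⊕ L) (syndrome-flip i y₂) ⟩
    syndrome y₁ ⊕ (syndrome y₂ ⊕ i) ⊕ L    ≡⟨ cong (_⊕ L) (⊕-assoc (syndrome y₁) (syndrome y₂) i) ⟨
    syndrome y₁ ⊕ syndrome y₂ ⊕ i ⊕ L      ≡⟨ ⊕-swapʳ (syndrome y₁ ⊕ syndrome y₂) i L ⟩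
    syndrome y₁ ⊕ syndrome y₂ ⊕ L ⊕ i      ∎
    where L = Maybe.fromMaybe 0ᵇ (firstOne u)

  flipY-twice-≢ : ∀ β {β′} i j w → β′ ≡ not β → flipY β′ j (flipY β i w) ≢ w
  flipY-twice-≢ true  i _ w refl eq = flip-≢ i (y₁ w) (cong y₁ eq)
  flipY-twice-≢ false i _ w refl eq = flip-≢ i (y₂ w) (cong y₂ eq)

  leafStep-spec : ∀ s w → Core s (leafStep s w) × Adjacent w (leafStep s w)
  leafStep-spec s w = by-hub (hub w) refl
    where
      S = syndrome (y₁ w) ⊕ syndrome (y₂ w)
      M = syndromeColour w

      by-hub : ∀ m → hub w ≡ m → Core s (leafStep s w) × Adjacent w (leafStep s w)
      by-hub (just _) h =
        subst (λ w′ → Core s w′ × Adjacent w w′) (sym (leafStep-hub w h)) (core′ , adjacent′)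
        where
          i = S ⊕ s
          w′ = record w { u = unit i }

          core′ : Core s w′
          core′ = core-nonhub w′ (hubOf-nonzero (z w) (unit i) (firstOne-unit i))
                    (trans (cong (λ m → S ⊕ Maybe.fromMaybe 0ᵇ m) (firstOne-unit i)) (⊕-cancelˡ S s))

          adjacent′ : Adjacent w w′
          adjacent′ = subst (λ b → Adjacent w (record w { u = flip i b }))
                            (proj₂ (hubOf-just (z w) (u w) h)) (adjacent-u i w)
      by-hub nothing h =
        subst (λ w′ → Core s w′ × Adjacent w w′) (sym (leafStep-nonhub w h))
          (core-nonhub (flipY β (M ⊕ s) w) (trans (flipY-hub β (M ⊕ s) w) h)
                       (trans (flipY-mixedColour β (M ⊕ s) w) (⊕-cancelˡ M s)) ,
           flipY-adjacent β (M ⊕ s) w)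
        where β = greater M s

  parent-core : ∀ s w → Core s (parent s w)
  parent-core s w with colour w ≟V s
  ... | yes c = proj₁ (coreStep-spec w c)
  ... | no  _ = proj₁ (leafStep-spec s w)

  parent-descends : ∀ s w → (w ≡ root s × parent s w ≡ w) ⊎
                            (rank s (parent s w) < rank s w × Adjacent w (parent s w))
  parent-descends s w with colour w ≟V s
  ... | yes c with coreStep-spec w c
  ...   | _     , inj₁ at-root         = inj₁ at-root
  ...   | core′ , inj₂ (lower , adj) =
    inj₂ (subst (_< coreRank s w) (sym (rank-core (coreStep s w) core′)) lower , adj)
  parent-descends s w | no _ =
    inj₂ (subst (_< suc (coreRank s (leafStep s w)))
                (sym (rank-core (leafStep s w) (proj₁ (leafStep-spec s w)))) ≤-refl ,
          proj₂ (leafStep-spec s w))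

  no-reversed-edge : ∀ {s s′} → s ≢ s′ → ∀ a b → parent s a ≡ b → parent s′ b ≡ a → ⊥
  -- a and b are leaves of the trees s and s′ attached to each other.  Leaving a hub makes u nonzero,
  -- which a leaf step from a non-hub keeps; two non-hub leaf steps flip different y-blocks.
  no-reversed-edge {s} {s′} s≢s′ a b a↑b b↑a = by-hub (hub a) refl
    where
      a-core : Core s′ a
      a-core = subst (Core s′) b↑a (parent-core s′ b)

      b-core : Core s b
      b-core = subst (Core s) a↑b (parent-core s a)

      a↑b′ : leafStep s a ≡ b
      a↑b′ = trans (sym (parent-leaf a λ c → s≢s′ (trans (sym c) a-core))) a↑b

      b↑a′ : leafStep s′ b ≡ a
      b↑a′ = trans (sym (parent-leaf b λ c → s≢s′ (trans (sym b-core) c))) b↑a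

      by-hub : ∀ m → hub a ≡ m → ⊥
      by-hub (just _) h with trans (sym (leafStep-hub a h)) a↑b′
      ... | refl = unit≢0ᴮ i (trans (sym u-a) (proj₂ (hubOf-just (z a) (u a) h)))
        where
          i = syndrome (y₁ a) ⊕ syndrome (y₂ a) ⊕ s
          u-a : u a ≡ unit i
          u-a = trans (cong u (sym b↑a′))
                (trans (cong u (leafStep-nonhub b (hubOf-nonzero (z a) (unit i) (firstOne-unit i))))
                       (flipY-u (greater (syndromeColour b) s′) (syndromeColour b ⊕ s′) b))
      by-hub nothing h with trans (sym (leafStep-nonhub a h)) a↑b′
      ... | refl = flipY-twice-≢ β (M ⊕ s) _ a opposite (trans (sym (leafStep-nonhub b b-nonhub)) b↑a′)
        where
          M = syndromeColour a
          β = greater M s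

          b-nonhub : hub b ≡ nothing
          b-nonhub = trans (flipY-hub β (M ⊕ s) a) h

          opposite : greater (syndromeColour b) s′ ≡ not β
          opposite = begin
            greater (syndromeColour b) s′ ≡⟨ cong (λ x → greater x s′) (syndromeColour-core b b-nonhub b-core) ⟩
            greater s s′                  ≡⟨ greater-antisym s≢s′ ⟩
            not (greater s′ s)            ≡⟨ cong (λ x → not (greater x s)) (syndromeColour-core a h a-core) ⟨
            not β                         ∎

  decode : V (dim t r) → Vertex
  decode x₀ = vertex (proj₁ (splitBlock x₀)) (proj₁ (splitBlock x₁)) (proj₁ (splitBlock x₂))
                     (proj₁ (splitBlock x₃)) (proj₂ (splitBlock {t} x₃))
    where
      x₁ = proj₂ (splitBlock {t} x₀)
      x₂ = proj₂ (splitBlock {t} x₁)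
      x₃ = proj₂ (splitBlock {t} x₂)

  decode-encode : ∀ w → decode (encode w) ≡ w
  decode-encode (vertex z u y₁ y₂ v)
    rewrite drop-++ (flatten z) (flatten u ++ flatten y₁ ++ flatten y₂ ++ v)
          | drop-++ (flatten u) (flatten y₁ ++ flatten y₂ ++ v)
          | drop-++ (flatten y₁) (flatten y₂ ++ v)
          | drop-++ (flatten y₂) v
    = vertex-cong (head-block z _) (head-block u _) (head-block y₁ _) (head-block y₂ _) refl
    where
      head-block : ∀ {k} (b : Block t) (x : Vec Bool k) → proj₁ (splitBlock (flatten b ++ x)) ≡ b
      head-block b x = cong proj₁ (splitBlock-++ b x)

  encode-decode : ∀ x → encode (decode x) ≡ x
  encode-decode x₀ = begin
    encode (decode x₀)              ≡⟨ cong (λ x → F x₀ ++ F x₁ ++ F x₂ ++ x) (flatten-splitBlock {t} x₃) ⟩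
    F x₀ ++ F x₁ ++ F x₂ ++ x₃      ≡⟨ cong (λ x → F x₀ ++ F x₁ ++ x) (flatten-splitBlock {t} x₂) ⟩
    F x₀ ++ F x₁ ++ x₂              ≡⟨ cong (F x₀ ++_) (flatten-splitBlock {t} x₁) ⟩
    F x₀ ++ x₁                      ≡⟨ flatten-splitBlock {t} x₀ ⟩
    x₀                              ∎
    where
      F : ∀ {k} → Vec Bool (pow2 t + k) → Vec Bool (pow2 t)
      F x = flatten (proj₁ (splitBlock {t} x))
      x₁ = proj₂ (splitBlock {t} x₀)
      x₂ = proj₂ (splitBlock {t} x₁)
      x₃ = proj₂ (splitBlock {t} x₂)

  parentᵛ : Bits t → V (dim t r) → V (dim t r)
  parentᵛ s x = encode (parent s (decode x))

  rankᵛ : Bits t → V (dim t r) → ℕ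
  rankᵛ s x = rank s (decode x)

  tree : Bits t → EdgeRel (dim t r)
  tree s = ParentTree.Edge (parentᵛ s) (rankᵛ s)

  rankᵛ-parentᵛ : ∀ s x → rankᵛ s (parentᵛ s x) ≡ rank s (parent s (decode x))
  rankᵛ-parentᵛ s x = cong (rank s) (decode-encode (parent s (decode x)))

  tree-isSpanningTree : ∀ s → IsSpanningTree (tree s)
  tree-isSpanningTree s =
    ParentTree.isSpanningTree (parentᵛ s) (rankᵛ s) (encode (root s)) toward-root adjacent
    where
      toward-root : ∀ x → x ≡ encode (root s) ⊎ rankᵛ s (parentᵛ s x) < rankᵛ s x
      toward-root x with parent-descends s (decode x)
      ... | inj₁ (at-root , _) = inj₁ (trans (sym (encode-decode x)) (cong encode at-root))
      ... | inj₂ (lower , _)   = inj₂ (subst (_< rankᵛ s x) (sym (rankᵛ-parentᵛ s x)) lower)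

      adjacent : ∀ x → rankᵛ s (parentᵛ s x) < rankᵛ s x → QAdj x (parentᵛ s x)
      adjacent x lower with parent-descends s (decode x)
      ... | inj₁ (_ , fixed) = contradiction (trans (rankᵛ-parentᵛ s x) (cong (rank s) fixed)) (<⇒≢ lower)
      ... | inj₂ (_ , adj)   = subst (λ y → hamming y (parentᵛ s x) ≡ 1) (encode-decode x) adj

  tree-completelyIndependent : ∀ {s s′} → s ≢ s′ → CompletelyIndependent (tree s) (tree s′)
  tree-completelyIndependent {s} {s′} s≢s′ =
    completelyIndependent (Core s ∘ decode) (Core s′ ∘ decode)
      (λ x → subst (Core s) (sym (decode-encode (parent s (decode x)))) (parent-core s (decode x)))
      (λ x → subst (Core s′) (sym (decode-encode (parent s′ (decode x)))) (parent-core s′ (decode x)))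
      (λ x c c′ → s≢s′ (trans (sym c) c′))
      (λ a b a↑b b↑a → no-reversed-edge s≢s′ (decode a) (decode b)
                         (trans (sym (decode-encode (parent s (decode a)))) (cong decode a↑b))
                         (trans (sym (decode-encode (parent s′ (decode b)))) (cong decode b↑a)))

toBits : ∀ t → Fin (pow2 t) → Bits t
toBits zero    _ = []
toBits (suc t) i = [ (false ∷_) ∘ toBits t , (true ∷_) ∘ toBits t ]′ (Fin.splitAt (pow2 t) i)

toBits-injective : ∀ t {i j : Fin (pow2 t)} → toBits t i ≡ toBits t j → i ≡ j
toBits-injective zero    {zero} {zero} _ = refl
toBits-injective (suc t) {i} {j} eq = begin
  i                              ≡⟨ join-splitAt S S i ⟨
  Fin.join S S (Fin.splitAt S i) ≡⟨ cong (Fin.join S S) (halves (Fin.splitAt S i) (Fin.splitAt S j) eq) ⟩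
  Fin.join S S (Fin.splitAt S j) ≡⟨ join-splitAt S S j ⟩
  j                              ∎
  where
    S = pow2 t

    bits : Fin S ⊎ Fin S → Bits (suc t)
    bits = [ (false ∷_) ∘ toBits t , (true ∷_) ∘ toBits t ]′

    halves : ∀ a b → bits a ≡ bits b → a ≡ b
    halves (inj₁ a) (inj₁ b) e = cong inj₁ (toBits-injective t (∷-injectiveʳ e))
    halves (inj₂ a) (inj₂ b) e = cong inj₂ (toBits-injective t (∷-injectiveʳ e))

cistFamily : ∀ t r → CISTFamily (dim t r) (pow2 t)
cistFamily t r = tree ∘ toBits t , tree-isSpanningTree ∘ toBits t ,
                 λ i j i≢j → tree-completelyIndependent (i≢j ∘ toBits-injective t)
  where open Construction t r

pow2-positive : ∀ t → 1 ≤ pow2 t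
pow2-positive zero    = s≤s z≤n
pow2-positive (suc t) = ≤-trans (pow2-positive t) (m≤m+n (pow2 t) (pow2 t))

dim-suc : ∀ t r → dim t (suc r) ≡ suc (dim t r)
dim-suc t r = identity (pow2 t) r
  where
    identity : ∀ S r → S + (S + (S + (S + suc r))) ≡ suc (S + (S + (S + (S + r))))
    identity = solve-∀

dim-double : ∀ t → dim (suc t) 0 ≡ dim t (4 * pow2 t)
dim-double t = identity (pow2 t)
  where
    identity : ∀ S → S + S + (S + S + (S + S + (S + S + 0))) ≡ S + (S + (S + (S + 4 * S)))
    identity = solve-∀

decompose : ∀ m → Σ ℕ λ t → Σ ℕ λ r → dim t r ≡ 4 + m × r < 4 * pow2 t
decompose zero = 0 , 0 , refl , s≤s z≤n
decompose (suc m) with decompose m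
... | t , r , dim≡ , r<4S with m≤n⇒m<n∨m≡n r<4S
...   | inj₁ r+1<4S = t , suc r , trans (dim-suc t r) (cong suc dim≡) , r+1<4S
...   | inj₂ r+1≡4S = suc t , 0 , dim≡′ , ≤-trans (pow2-positive (suc t)) (m≤n*m (pow2 (suc t)) 4)
  where
    dim≡′ : dim (suc t) 0 ≡ 4 + suc m
    dim≡′ = begin
      dim (suc t) 0      ≡⟨ dim-double t ⟩
      dim t (4 * pow2 t) ≡⟨ cong (dim t) r+1≡4S ⟨
      dim t (suc r)      ≡⟨ dim-suc t r ⟩
      suc (dim t r)      ≡⟨ cong suc dim≡ ⟩
      4 + suc m          ∎

dim≤8·pow2 : ∀ t r → r < 4 * pow2 t → 1 * dim t r ≤ 8 * pow2 t
dim≤8·pow2 t r r<4S =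
  subst₂ _≤_ (sym (lhs (pow2 t) r)) (sym (rhs (pow2 t))) (+-monoʳ-≤ (4 * pow2 t) (<⇒≤ r<4S))
  where
    lhs : ∀ S r → 1 * (S + (S + (S + (S + r)))) ≡ 4 * S + r
    lhs = solve-∀

    rhs : ∀ S → 8 * S ≡ 4 * S + 4 * S
    rhs = solve-∀

theorem1 : Σ ℕ λ p → Σ ℕ λ q → 1 ≤ p × 1 ≤ q × Σ ℕ λ n₀ →
    ∀ n → n ≥ n₀ → Σ ℕ λ k → p * n ≤ q * k × CISTFamily n k
theorem1 = 1 , 8 , ≤-refl , s≤s z≤n , 4 , family
  where
    family : ∀ n → n ≥ 4 → Σ ℕ λ k → 1 * n ≤ 8 * k × CISTFamily n k
    family n n≥4 with m≤n⇒∃[o]m+o≡n n≥4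
    ... | m , refl with decompose m
    ...   | t , r , dim≡ , r<4S =
      pow2 t , subst (λ n → 1 * n ≤ 8 * pow2 t × CISTFamily n (pow2 t)) dim≡
                     (dim≤8·pow2 t r r<4S , cistFamily t r)
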